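{- In the setting below, the map $h$ satisfies, for all $a,b\in K$: $h(\top)=\Sigma^+$; $h(a\cdot b)=(h(a)\cdot h(b))^{\rhd\lhd}$; $h(a\backslash b)=h(a)\backslash h(b)$; $h(b/a)=h(b)/h(a)$; $h(a\wedge b)=h(a)\cap h(b)$; $h(a\vee b)=(h(a)\cup h(b))^{\rhd\lhd}$; $h(a^+)=\big(\bigcup_{n\ge1}h(a)^n\big)^{\rhd\lhd}$. Moreover, if $a\preceq b$ in $\mathcal K$ then $h(a)\subseteq h(b)$.
   Context: Let $\mathcal K=(K;\preceq,\cdot,\backslash,/,\wedge,\vee,\top,\bot,{}^+)$ be an $\omega$PAL: $(K;\preceq,\wedge,\vee,\top,\bot)$ a bounded lattice, $\cdot$ associative, $b\preceq a\backslash c\iff a\cdot b\preceq c\iff a\preceq c/b$, $a^+=\sup\{a^n\mid n\ge1\}$. Let $\overline\Sigma=\{\overline a\mid a\in K\}$, $\underline\Sigma=\{\underline b\mid b\in K\}$ be disjoint copies of $K$, $\Sigma=\overline\Sigma\cup\underline\Sigma$. For $w=\overline{a_1}\cdots\overline{a_n}\in\overline\Sigma^+$, $w^\bullet=a_1\cdot\ldots\cdot a_n$; $|x|_{\underline\Sigma}$ counts letters from $\underline\Sigma$. $L=\{w\underline b\mid w\in\overline\Sigma^+,b\in K,w^\bullet\preceq b\}\cup\{x\in\Sigma^+\mid|x|_{\underline\Sigma}\ge2\}$ and $h(b)=\{x\in\Sigma^+\mid x\underline b\in L\}$. For $M\subseteq\Sigma^+$, $M^{\rhd}=\{(x,y)\in\Sigma^*\times\Sigma^*\mid\forall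 w\in M\;xwy\in L\}$; for $C\subseteq\Sigma^*\times\Sigma^*$, $C^{\lhd}=\{v\in\Sigma^+\mid\forall(x,y)\in C\;xvy\in L\}$. For $M_1,M_2\subseteq\Sigma^+$: $M_1\cdot M_2$ is concatenation, $M_1\backslash M_2=\{u\in\Sigma^+\mid\forall v\in M_1\;vu\in M_2\}$, $M_2/M_1=\{u\in\Sigma^+\mid\forall v\in M_1\;uv\in M_2\}$. -}

module Defs where

open import Data.Nat using (ℕ; zero; suc; _≥_)
open import Data.List using (List; []; _∷_; _++_; [_]; map)
open import Data.Empty renaming (⊥ to Empty)
open import Data.Unit renaming (⊤ to Unit)
open import Data.Sum using (_⊎_; inj₁; inj₂)
open import Data.Product using (Σ; ∃; _×_; _,_)
open import Relation.Binary.PropositionalEquality using (_≡_)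
open import Relation.Binary.Lattice.Structures using (IsBoundedLattice)

-- positive powers: powWith _·_ a n = a^(n+1)
powWith : {K : Set} → (K → K → K) → K → ℕ → K
powWith _·_ a zero    = a
powWith _·_ a (suc n) = powWith _·_ a n · a

record ωPAL : Set₁ where
  infixl 7 _·_
  field
    K    : Set
    _≼_  : K → K → Set
    _·_  : K → K → K
    _＼_ : K → K → K
    _／_ : K → K → K
    _∧_  : K → K → K
    _∨_  : K → K → K
    ⊤    : K
    ⊥    : K
    _⁺   : K → K
    isBoundedLattice : IsBoundedLattice _≡_ _≼_ _∨_ _∧_ ⊤ ⊥
    ·-assoc : ∀ a b c → (a · b) · c ≡ a · (b · c)
    resˡ₁ : ∀ a b c → b ≼ (a ＼ c) → (a · b) ≼ c
    resˡ₂ : ∀ a b c → (a · b) ≼ c → b ≼ (a ＼ c)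
    resʳ₁ : ∀ a b c → a ≼ (c ／ b) → (a · b) ≼ c
    resʳ₂ : ∀ a b c → (a · b) ≼ c → a ≼ (c ／ b)

    ⁺-upper : ∀ a n → powWith _·_ a n ≼ (a ⁺)
    ⁺-least : ∀ a c → (∀ n → powWith _·_ a n ≼ c) → (a ⁺) ≼ c

module Construction (𝒦 : ωPAL) where
  open ωPAL 𝒦

  Letter : Set
  Letter = K ⊎ K

  over : K → Letter
  over = inj₁

  under : K → Letter
  under = inj₂

  Word : Set
  Word = List Letter

  NonEmpty : Word → Set
  NonEmpty []      = Empty
  NonEmpty (_ ∷ _) = Unit

  countU : Word → ℕ
  countU []            = zero
  countU (inj₁ _ ∷ x)  = countU x
  countU (inj₂ _ ∷ x)  = suc (countU x)

  prod : K → List K → K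
  prod a []       = a
  prod a (c ∷ cs) = a · prod c cs

  L : Word → Set
  L x = (Σ K λ a₁ → Σ (List K) λ as → Σ K λ b →
           (x ≡ map over (a₁ ∷ as) ++ [ under b ]) × (prod a₁ as ≼ b))
        ⊎ (countU x ≥ 2)

  Lang : Set₁
  Lang = Word → Set

  PairSet : Set₁
  PairSet = Word → Word → Set

  Σ⁺ : Lang
  Σ⁺ = NonEmpty

  h : K → Lang
  h b x = NonEmpty x × L (x ++ [ under b ])

  _▷ : Lang → PairSet
  (M ▷) x y = ∀ w → M w → L (x ++ w ++ y)

  _◁ : PairSet → Lang
  (C ◁) v = NonEmpty v × (∀ x y → C x y → L (x ++ v ++ y))

  cl : Lang → Lang
  cl M = (M ▷) ◁

  _⊙_ : Lang → Lang → Lang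
  (M₁ ⊙ M₂) w = Σ Word λ u → Σ Word λ v → M₁ u × M₂ v × (w ≡ u ++ v)

  _⧵_ : Lang → Lang → Lang
  (M₁ ⧵ M₂) u = NonEmpty u × (∀ v → M₁ v → M₂ (v ++ u))

  _⧸_ : Lang → Lang → Lang
  (M₂ ⧸ M₁) u = NonEmpty u × (∀ v → M₁ v → M₂ (u ++ v))

  _∩_ : Lang → Lang → Lang
  (M₁ ∩ M₂) w = M₁ w × M₂ w

  _∪_ : Lang → Lang → Lang
  (M₁ ∪ M₂) w = M₁ w ⊎ M₂ w

  -- powM M n = M^(n+1)
  powM : Lang → ℕ → Lang
  powM M zero    = M
  powM M (suc n) = powM M n ⊙ M

  ⋃pow : Lang → Lang
  ⋃pow M w = Σ ℕ λ n → powM M n w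

  _⊆_ : Lang → Lang → Set
  M₁ ⊆ M₂ = ∀ w → M₁ w → M₂ w

  _≐_ : Lang → Lang → Set
  M₁ ≐ M₂ = (M₁ ⊆ M₂) × (M₂ ⊆ M₁)

-- A nonempty word lies in h t iff it contains an underlined letter, or it is an overlined word
-- w with w• ≼ t. Monotonicity, ⊤, meets and residuals therefore only concern overlined words,
-- where they are residuation in K. For the closures, classify the contexts (p , q) of L: one that
-- accepts d̲ ē already carries an underlined letter, and one that accepts an overlined word either
-- carries two underlined letters or is (p̄s , q̄s c̲), which accepts exactly the overlined w with
-- ps• · w• · qs• ≼ c, i.e. w• ≼ residual ps qs c. So h t ⊆ cl M once M contains d̲ ē and some
-- overlined word, and t is below every residual that bounds all overlined words of M.
module Submission where

open import Defs
open import Data.Product using (_×_; _,_; ∃; ∃₂; proj₁; proj₂)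
open import Data.Nat using (zero; suc; _+_; _≤_; z≤n; s≤s; s≤s⁻¹)
open import Data.Nat.Properties using (+-suc; +-monoˡ-≤; +-monoʳ-≤; m≤m+n; m≤n+m; ≤-trans; module ≤-Reasoning)
open import Data.List using (List; []; _∷_; _++_; [_]; map; foldr; foldl)
open import Data.List.Properties using (map-++; ++-assoc; ++-identityʳ; ∷-injective; ∷ʳ-injective; map-injective; ++-conicalʳ)
open import Data.Sum using (_⊎_; inj₁; inj₂)
open import Data.Sum.Properties using (inj₁-injective; inj₂-injective)
open import Data.Unit using (tt)
open import Function using (flip; _∘_)
open import Function.Bundles using (_⇔_; mk⇔; Equivalence)
open import Function.Properties.Equivalence using () renaming (refl to ⇔-refl; trans to ⇔-trans)
open import Relation.Binary.PropositionalEquality using (_≡_; refl; sym; trans; cong; subst; subst₂; module ≡-Reasoning)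
open import Relation.Binary.Lattice.Structures using (IsBoundedLattice)

open Equivalence using (to; from)

module Properties (𝒦 : ωPAL) where
  open ωPAL 𝒦
  open Construction 𝒦
  open IsBoundedLattice isBoundedLattice
    using (maximum; x≤x∨y; y≤x∨y; ∨-least; x∧y≤x; x∧y≤y; ∧-greatest)
    renaming (refl to ≼-refl; trans to ≼-trans)

  ·-monoˡ-≼ : ∀ {x a} b → x ≼ a → (x · b) ≼ (a · b)
  ·-monoˡ-≼ {x} {a} b x≼a = resʳ₁ x b (a · b) (≼-trans x≼a (resʳ₂ a b (a · b) ≼-refl))

  ·-monoʳ-≼ : ∀ x {y b} → y ≼ b → (x · y) ≼ (x · b)
  ·-monoʳ-≼ x {y} {b} y≼b = resˡ₁ x y (x · b) (≼-trans y≼b (resˡ₂ x b (x · b) ≼-refl))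

  ·-mono-≼ : ∀ {x y a b} → x ≼ a → y ≼ b → (x · y) ≼ (a · b)
  ·-mono-≼ {y = y} {a} x≼a y≼b = ≼-trans (·-monoˡ-≼ y x≼a) (·-monoʳ-≼ a y≼b)

  foldr-·-residual : ∀ ps s c → foldr _·_ s ps ≼ c ⇔ s ≼ foldl (flip _＼_) c ps
  foldr-·-residual []       s c = ⇔-refl
  foldr-·-residual (p ∷ ps) s c =
    ⇔-trans (mk⇔ (resˡ₂ p _ c) (resˡ₁ p _ c)) (foldr-·-residual ps s (p ＼ c))

  foldl-·-residual : ∀ qs s c → foldl _·_ s qs ≼ c ⇔ s ≼ foldr (flip _／_) c qs
  foldl-·-residual []       s c = ⇔-refl
  foldl-·-residual (q ∷ qs) s c =
    ⇔-trans (foldl-·-residual qs (s · q) c) (mk⇔ (resʳ₂ s q _) (resʳ₁ s q _))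

  -- the largest s with ps• · s · qs• ≼ c (an empty ps or qs contributes no factor)
  residual : List K → List K → K → K
  residual ps qs c = foldr (flip _／_) (foldl (flip _＼_) c ps) qs

  prod-++-foldr : ∀ p ps k ks → prod p (ps ++ k ∷ ks) ≡ foldr _·_ (prod k ks) (p ∷ ps)
  prod-++-foldr p []        k ks = refl
  prod-++-foldr p (p′ ∷ ps) k ks = cong (p ·_) (prod-++-foldr p′ ps k ks)

  foldr-·-prod : ∀ k ks s → foldr _·_ s (k ∷ ks) ≡ prod k ks · s
  foldr-·-prod k []        s = refl
  foldr-·-prod k (k′ ∷ ks) s =
    trans (cong (k ·_) (foldr-·-prod k′ ks s)) (sym (·-assoc k (prod k′ ks) s))

  prod-++ : ∀ k ks k′ ks′ → prod k (ks ++ k′ ∷ ks′) ≡ prod k ks · prod k′ ks′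
  prod-++ k ks k′ ks′ = trans (prod-++-foldr k ks k′ ks′) (foldr-·-prod k ks (prod k′ ks′))

  prod-++-foldl : ∀ k ks qs → prod k (ks ++ qs) ≡ foldl _·_ (prod k ks) qs
  prod-++-foldl k ks []       = cong (prod k) (++-identityʳ ks)
  prod-++-foldl k ks (q ∷ qs) = begin
    prod k (ks ++ q ∷ qs)                ≡⟨ cong (prod k) (++-assoc ks [ q ] qs) ⟨
    prod k ((ks ++ [ q ]) ++ qs)         ≡⟨ prod-++-foldl k (ks ++ [ q ]) qs ⟩
    foldl _·_ (prod k (ks ++ [ q ])) qs  ≡⟨ cong (λ s → foldl _·_ s qs) (prod-++ k ks q []) ⟩
    foldl _·_ (prod k ks · q) qs         ∎
    where open ≡-Reasoning

  countU-++ : ∀ x y → countU (x ++ y) ≡ countU x + countU y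
  countU-++ []           y = refl
  countU-++ (inj₁ _ ∷ x) y = countU-++ x y
  countU-++ (inj₂ _ ∷ x) y = cong suc (countU-++ x y)

  countU-map-over : ∀ ks → countU (map over ks) ≡ 0
  countU-map-over []       = refl
  countU-map-over (_ ∷ ks) = countU-map-over ks

  countU-overlined-under : ∀ ks c → countU (map over ks ++ [ under c ]) ≡ 1
  countU-overlined-under ks c = trans (countU-++ (map over ks) _) (cong (_+ 1) (countU-map-over ks))

  countU-around-overlined : ∀ p ks q → countU (p ++ map over ks ++ q) ≡ countU p + countU q
  countU-around-overlined p ks q = begin
    countU (p ++ map over ks ++ q)
      ≡⟨ countU-++ p _ ⟩
    countU p + countU (map over ks ++ q)
      ≡⟨ cong (countU p +_) (countU-++ (map over ks) q) ⟩
    countU p + (countU (map over ks) + countU q)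
      ≡⟨ cong (λ n → countU p + (n + countU q)) (countU-map-over ks) ⟩
    countU p + countU q
      ∎
    where open ≡-Reasoning

  countU-++-≥ˡ : ∀ x y → 1 ≤ countU x → 1 ≤ countU (x ++ y)
  countU-++-≥ˡ x y 1≤x = subst (1 ≤_) (sym (countU-++ x y)) (≤-trans 1≤x (m≤m+n _ _))

  countU-++-≥ʳ : ∀ x y → 1 ≤ countU y → 1 ≤ countU (x ++ y)
  countU-++-≥ʳ x y 1≤y = subst (1 ≤_) (sym (countU-++ x y)) (≤-trans 1≤y (m≤n+m _ _))

  countU-≥⇒NonEmpty : ∀ {x} → 1 ≤ countU x → NonEmpty x
  countU-≥⇒NonEmpty {_ ∷ _} _ = tt

  data Shape : Word → Set where
    underlined : ∀ {x} → 1 ≤ countU x → Shape x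
    overlined  : ∀ k ks → Shape (map over (k ∷ ks))

  shape : ∀ x → NonEmpty x → Shape x
  shape (inj₂ _ ∷ x)     _ = underlined (s≤s z≤n)
  shape (inj₁ k ∷ [])    _ = overlined k []
  shape (inj₁ k ∷ y ∷ x) _ with shape (y ∷ x) tt
  ... | underlined 1≤x  = underlined 1≤x
  ... | overlined k′ ks = overlined k (k′ ∷ ks)

  overlined-prefix : ∀ p r {ℓ c} → NonEmpty r → p ++ r ≡ map over ℓ ++ [ under c ]
                   → ∃ λ ps → p ≡ map over ps
  overlined-prefix []      _ _       _  = [] , refl
  overlined-prefix (_ ∷ p) (_ ∷ _) {[]}    _  eq with () ← ++-conicalʳ p _ (proj₂ (∷-injective eq))
  overlined-prefix (_ ∷ p) r       {_ ∷ _} ne eq with refl , eq′ ← ∷-injective eq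
    with ps , refl ← overlined-prefix p r ne eq′ = _ ∷ ps , refl

  overlined-suffix : ∀ ks q {ℓ c} → map over ks ++ q ≡ map over ℓ ++ [ under c ]
                   → ∃ λ qs → q ≡ map over qs ++ [ under c ]
  overlined-suffix []       q {ℓ}     eq = ℓ , eq
  overlined-suffix (_ ∷ _)  _ {[]}    ()
  overlined-suffix (_ ∷ ks) q {_ ∷ ℓ} eq = overlined-suffix ks q (proj₂ (∷-injective eq))

  data OverlinedContext : Word → Word → Set where
    overlined-context : ∀ ps qs c → OverlinedContext (map over ps) (map over qs ++ [ under c ])

  L-overlined : ∀ k ks c → L (map over (k ∷ ks) ++ [ under c ]) ⇔ (prod k ks ≼ c)
  L-overlined k ks c = mk⇔ fromL (λ le → inj₁ (k , ks , c , refl , le))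
    where
    fromL : L (map over (k ∷ ks) ++ [ under c ]) → prod k ks ≼ c
    fromL (inj₁ (a , as , b , eq , le))
      with eqˡ , eqʳ ← ∷ʳ-injective (map over (k ∷ ks)) (map over (a ∷ as)) eq
      with refl ← map-injective inj₁-injective {k ∷ ks} {a ∷ as} eqˡ
         | refl ← inj₂-injective eqʳ = le
    fromL (inj₂ 2≤n) with s≤s () ← subst (2 ≤_) (countU-overlined-under (k ∷ ks) c) 2≤n

  L-overlined-prefixed : ∀ ps k ks c →
    L (map over (ps ++ k ∷ ks) ++ [ under c ]) ⇔ (foldr _·_ (prod k ks) ps ≼ c)
  L-overlined-prefixed []       k ks c = L-overlined k ks c
  L-overlined-prefixed (p ∷ ps) k ks c =
    subst (λ s → L (map over (p ∷ ps ++ k ∷ ks) ++ [ under c ]) ⇔ (s ≼ c))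
          (prod-++-foldr p ps k ks) (L-overlined p (ps ++ k ∷ ks) c)

  plug-overlined : ∀ ps k ks qs c →
    map over ps ++ map over (k ∷ ks) ++ map over qs ++ [ under c ]
      ≡ map over (ps ++ k ∷ ks ++ qs) ++ [ under c ]
  plug-overlined ps k ks qs c = begin
    map over ps ++ map over (k ∷ ks) ++ map over qs ++ [ under c ]
      ≡⟨ cong (map over ps ++_) (++-assoc (map over (k ∷ ks)) (map over qs) _) ⟨
    map over ps ++ (map over (k ∷ ks) ++ map over qs) ++ [ under c ]
      ≡⟨ cong (λ w → map over ps ++ w ++ [ under c ]) (map-++ over (k ∷ ks) qs) ⟨
    map over ps ++ map over (k ∷ ks ++ qs) ++ [ under c ]
      ≡⟨ ++-assoc (map over ps) _ _ ⟨
    (map over ps ++ map over (k ∷ ks ++ qs)) ++ [ under c ]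
      ≡⟨ cong (_++ [ under c ]) (map-++ over ps (k ∷ ks ++ qs)) ⟨
    map over (ps ++ k ∷ ks ++ qs) ++ [ under c ]
      ∎
    where open ≡-Reasoning

  L-in-overlined-context : ∀ ps k ks qs c →
    L (map over ps ++ map over (k ∷ ks) ++ map over qs ++ [ under c ]) ⇔ (prod k ks ≼ residual ps qs c)
  L-in-overlined-context ps k ks qs c =
    ⇔-trans (subst₂ (λ w s → L w ⇔ (foldr _·_ s ps ≼ c))
                    (sym (plug-overlined ps k ks qs c)) (prod-++-foldl k ks qs)
                    (L-overlined-prefixed ps k (ks ++ qs) c))
            (⇔-trans (foldr-·-residual ps _ c) (foldl-·-residual qs _ _))

  L-around-overlined : ∀ p q {k ks} → L (p ++ map over (k ∷ ks) ++ q)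
                     → (2 ≤ countU p + countU q) ⊎ OverlinedContext p q
  L-around-overlined p q {k} {ks} (inj₂ 2≤n) =
    inj₁ (subst (2 ≤_) (countU-around-overlined p (k ∷ ks) q) 2≤n)
  L-around-overlined p q (inj₁ (a , as , c , eq , _))
    with ps , refl ← overlined-prefix p _ {a ∷ as} tt eq
    with _ , eq′ ← overlined-suffix ps _ {a ∷ as} eq
    with qs , refl ← overlined-suffix (_ ∷ _) q {c = c} eq′ = inj₂ (overlined-context ps qs c)

  L-around-under-over : ∀ p q {d e} → L (p ++ under d ∷ over e ∷ q) → 1 ≤ countU p + countU q
  L-around-under-over p q {d} {e} (inj₂ 2≤n) = s≤s⁻¹ (begin
    2                                     ≤⟨ 2≤n ⟩
    countU (p ++ under d ∷ over e ∷ q)    ≡⟨ countU-++ p _ ⟩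
    countU p + suc (countU q)             ≡⟨ +-suc (countU p) _ ⟩
    suc (countU p + countU q)             ∎)
    where open ≤-Reasoning
  L-around-under-over p q (inj₁ (a , as , c , eq , _))
    with ps , refl ← overlined-prefix p _ {a ∷ as} tt eq
    with overlined-suffix ps _ {a ∷ as} eq
  ... | []    , ()
  ... | _ ∷ _ , ()

  L-underlined-around : ∀ p x q → 1 ≤ countU p + countU q → 1 ≤ countU x → L (p ++ x ++ q)
  L-underlined-around p x q 1≤pq 1≤x = inj₂ (begin
    2                                    ≤⟨ s≤s 1≤pq ⟩
    suc (countU p + countU q)            ≡⟨ +-suc (countU p) _ ⟨
    countU p + suc (countU q)            ≤⟨ +-monoʳ-≤ (countU p) (+-monoˡ-≤ (countU q) 1≤x) ⟩
    countU p + (countU x + countU q)     ≡⟨ cong (countU p +_) (countU-++ x q) ⟨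
    countU p + countU (x ++ q)           ≡⟨ countU-++ p _ ⟨
    countU (p ++ x ++ q)                 ∎)
    where open ≤-Reasoning

  h-underlined : ∀ {t} x → 1 ≤ countU x → h t x
  h-underlined x 1≤x = countU-≥⇒NonEmpty 1≤x , L-underlined-around [] x _ (s≤s z≤n) 1≤x

  h-overlined : ∀ t k ks → h t (map over (k ∷ ks)) ⇔ (prod k ks ≼ t)
  h-overlined t k ks = mk⇔ (λ (_ , l) → to (L-overlined k ks t) l)
                           (λ le → tt , from (L-overlined k ks t) le)

  h-overlined-++ : ∀ t k ks k′ ks′ →
    h t (map over (k ∷ ks) ++ map over (k′ ∷ ks′)) ⇔ ((prod k ks · prod k′ ks′) ≼ t)
  h-overlined-++ t k ks k′ ks′ =
    subst₂ (λ w s → h t w ⇔ (s ≼ t)) (map-++ over (k ∷ ks) (k′ ∷ ks′)) (prod-++ k ks k′ ks′)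
           (h-overlined t k (ks ++ k′ ∷ ks′))

  over∈h : ∀ a → h a [ over a ]
  over∈h a = from (h-overlined a a []) ≼-refl

  ⊆h : ∀ {M t} → M ⊆ Σ⁺ → (∀ k ks → M (map over (k ∷ ks)) → prod k ks ≼ t) → M ⊆ h t
  ⊆h M⊆Σ⁺ bounded x x∈M with shape x (M⊆Σ⁺ x x∈M)
  ... | underlined 1≤x = h-underlined x 1≤x
  ... | overlined k ks = from (h-overlined _ k ks) (bounded k ks x∈M)

  h-mono : ∀ a b → a ≼ b → h a ⊆ h b
  h-mono a b a≼b = ⊆h (λ _ → proj₁) (λ k ks x∈ha → ≼-trans (to (h-overlined a k ks) x∈ha) a≼b)

  h-⊙ : ∀ a b → (h a ⊙ h b) ⊆ h (a · b)
  h-⊙ a b _ (u , v , u∈ha , v∈hb , refl)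
    with shape u (proj₁ u∈ha) | shape v (proj₁ v∈hb)
  ... | underlined 1≤u | _              = h-underlined (u ++ v) (countU-++-≥ˡ u v 1≤u)
  ... | overlined _ _  | underlined 1≤v = h-underlined (u ++ v) (countU-++-≥ʳ u v 1≤v)
  ... | overlined k ks | overlined k′ ks′ =
    from (h-overlined-++ _ k ks k′ ks′)
         (·-mono-≼ (to (h-overlined a k ks) u∈ha) (to (h-overlined b k′ ks′) v∈hb))

  cl⊆h : ∀ {M t} → M ⊆ h t → cl M ⊆ h t
  cl⊆h {t = t} M⊆ht v (v∈Σ⁺ , v∈cl) = v∈Σ⁺ , v∈cl [] [ under t ] (λ w w∈M → proj₂ (M⊆ht w w∈M))

  ▷-residual : ∀ {M} ps qs c k ks → (M ▷) (map over ps) (map over qs ++ [ under c ])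
             → M (map over (k ∷ ks)) → prod k ks ≼ residual ps qs c
  ▷-residual ps qs c k ks pq w∈M = to (L-in-overlined-context ps k ks qs c) (pq _ w∈M)

  h⊆cl : ∀ {M t d e k ks} → M (under d ∷ over e ∷ []) → M (map over (k ∷ ks))
       → (∀ ps qs c → (M ▷) (map over ps) (map over qs ++ [ under c ]) → t ≼ residual ps qs c)
       → h t ⊆ cl M
  h⊆cl {M} {t} de∈M k∈M bounded x x∈ht =
    proj₁ x∈ht , λ p q pq → plug p q pq x∈ht (shape x (proj₁ x∈ht))
    where
    plug : ∀ {x} p q → (M ▷) p q → h t x → Shape x → L (p ++ x ++ q)
    plug {x} p q pq _ (underlined 1≤x) =
      L-underlined-around p x q (L-around-under-over p q (pq _ de∈M)) 1≤x
    plug p q pq x∈ht (overlined k′ ks′) with L-around-overlined p q (pq _ k∈M)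
    ... | inj₁ 2≤pq = inj₂ (subst (2 ≤_) (sym (countU-around-overlined p (k′ ∷ ks′) q)) 2≤pq)
    ... | inj₂ (overlined-context ps qs c) =
      from (L-in-overlined-context ps k′ ks′ qs c)
           (≼-trans (to (h-overlined t k′ ks′) x∈ht) (bounded ps qs c pq))

  h-⊤ : h ⊤ ≐ Σ⁺
  h-⊤ = (λ _ → proj₁) , ⊆h (λ _ x∈Σ⁺ → x∈Σ⁺) (λ _ _ _ → maximum _)

  h-· : ∀ a b → h (a · b) ≐ cl (h a ⊙ h b)
  h-· a b = h⊆cl {k = a} {ks = [ b ]} a̲b̄∈M āb̄∈M (λ ps qs c pq → ▷-residual ps qs c a [ b ] pq āb̄∈M)
          , cl⊆h (h-⊙ a b)
    where
    a̲b̄∈M : (h a ⊙ h b) (under a ∷ over b ∷ [])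
    a̲b̄∈M = [ under a ] , [ over b ] , h-underlined [ under a ] (s≤s z≤n) , over∈h b , refl
    āb̄∈M : (h a ⊙ h b) (map over (a ∷ b ∷ []))
    āb̄∈M = [ over a ] , [ over b ] , over∈h a , over∈h b , refl

  h-＼ : ∀ a b → h (a ＼ b) ≐ (h a ⧵ h b)
  h-＼ a b = (λ u u∈h → proj₁ u∈h , λ v v∈ha →
                h-mono _ b (resˡ₁ a (a ＼ b) b ≼-refl) (v ++ u)
                       (h-⊙ a (a ＼ b) _ (v , u , v∈ha , u∈h , refl)))
           , ⊆h (λ _ → proj₁) (λ k ks (_ , f) →
                resˡ₂ a (prod k ks) b (to (h-overlined b a (k ∷ ks)) (f [ over a ] (over∈h a))))

  h-／ : ∀ a b → h (b ／ a) ≐ (h b ⧸ h a)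
  h-／ a b = (λ u u∈h → proj₁ u∈h , λ v v∈ha →
                h-mono _ b (resʳ₁ (b ／ a) a b ≼-refl) (u ++ v)
                       (h-⊙ (b ／ a) a _ (u , v , u∈h , v∈ha , refl)))
           , ⊆h (λ _ → proj₁) (λ k ks (_ , f) →
                resʳ₂ (prod k ks) a b (to (h-overlined-++ b k ks a []) (f [ over a ] (over∈h a))))

  h-∧ : ∀ a b → h (a ∧ b) ≐ (h a ∩ h b)
  h-∧ a b = (λ x x∈h → h-mono _ a (x∧y≤x a b) x x∈h , h-mono _ b (x∧y≤y a b) x x∈h)
          , ⊆h (λ _ → proj₁ ∘ proj₁) (λ k ks (x∈ha , x∈hb) →
                ∧-greatest (to (h-overlined a k ks) x∈ha) (to (h-overlined b k ks) x∈hb))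

  h-∨ : ∀ a b → h (a ∨ b) ≐ cl (h a ∪ h b)
  h-∨ a b = h⊆cl {k = a} {ks = []} (inj₁ (h-underlined (under a ∷ over a ∷ []) (s≤s z≤n)))
                 (inj₁ (over∈h a))
                 (λ ps qs c pq → ∨-least (▷-residual ps qs c a [] pq (inj₁ (over∈h a)))
                                         (▷-residual ps qs c b [] pq (inj₂ (over∈h b))))
          , cl⊆h λ { w (inj₁ w∈ha) → h-mono a _ (x≤x∨y a b) w w∈ha
                 ; w (inj₂ w∈hb) → h-mono b _ (y≤x∨y a b) w w∈hb }

  powM⊆h : ∀ a n → powM (h a) n ⊆ h (powWith _·_ a n)
  powM⊆h a zero    _ w∈M = w∈M
  powM⊆h a (suc n) w (u , v , u∈Mⁿ , v∈M , w≡uv) =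
    h-⊙ _ a w (u , v , powM⊆h a n u u∈Mⁿ , v∈M , w≡uv)

  overlined∈powM : ∀ a n →
    ∃₂ λ k ks → powM (h a) n (map over (k ∷ ks)) × prod k ks ≡ powWith _·_ a n
  overlined∈powM a zero = a , [] , over∈h a , refl
  overlined∈powM a (suc n) with k , ks , w∈Mⁿ , ks≡aⁿ ← overlined∈powM a n =
    k , ks ++ [ a ] , (map over (k ∷ ks) , [ over a ] , w∈Mⁿ , over∈h a , map-++ over (k ∷ ks) [ a ])
      , trans (prod-++ k ks a []) (cong (_· a) ks≡aⁿ)

  h-⁺ : ∀ a → h (a ⁺) ≐ cl (⋃pow (h a))
  h-⁺ a = h⊆cl {k = a} {ks = []} (0 , h-underlined (under a ∷ over a ∷ []) (s≤s z≤n)) (0 , over∈h a)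
                (λ ps qs c pq → ⁺-least a _ (power-bounded ps qs c pq))
        , cl⊆h (λ w (n , w∈Mⁿ) → h-mono _ _ (⁺-upper a n) w (powM⊆h a n w w∈Mⁿ))
    where
    power-bounded : ∀ ps qs c → (⋃pow (h a) ▷) (map over ps) (map over qs ++ [ under c ])
                  → ∀ n → powWith _·_ a n ≼ residual ps qs c
    power-bounded ps qs c pq n with k , ks , w∈Mⁿ , ks≡aⁿ ← overlined∈powM a n =
      subst (_≼ residual ps qs c) ks≡aⁿ (▷-residual ps qs c k ks pq (n , w∈Mⁿ))

lemma5 : (𝒦 : ωPAL) → let open ωPAL 𝒦 in let open Construction 𝒦 in
    (h ⊤ ≐ Σ⁺)
    × (∀ a b → h (a · b) ≐ cl (h a ⊙ h b))
    × (∀ a b → h (a ＼ b) ≐ (h a ⧵ h b))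
    × (∀ a b → h (b ／ a) ≐ (h b ⧸ h a))
    × (∀ a b → h (a ∧ b) ≐ (h a ∩ h b))
    × (∀ a b → h (a ∨ b) ≐ cl (h a ∪ h b))
    × (∀ a → h (a ⁺) ≐ cl (⋃pow (h a)))
    × (∀ a b → a ≼ b → h a ⊆ h b)
lemma5 𝒦 = h-⊤ , h-· , h-＼ , h-／ , h-∧ , h-∨ , h-⁺ , h-mono
  where open Properties 𝒦
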